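{- Let $A$ be a nonempty finite set of nonnegative integers with $a^* = \max(A)$. Let $m$ be a positive integer with $m > 2a^*$, let $n$ be a positive integer, and let \[B := \left\{\sum_{i=0}^{n-1} a_i m^i : a_i \in A \text{ for all } i = 0, 1, \ldots, n-1\right\}.\] Then $|B| = |A|^n$, $|B \dotplus B| \geq |A \dotplus A|^n$, and $|B - B| = |A - A|^n$.
   Context: For a nonempty finite set $A \subseteq \mathbb{Z}$, define $A - A := \{a - b : a, b \in A\}$ and the restricted sumset $A \dotplus A := \{a + b : a, b \in A,\ a \neq b\}$. -}

module Defs where

import Data.Nat
import Data.List
open import Data.Nat using (ℕ; zero; suc; _+_; _*_; _^_)
open import Data.Integer as ℤ using (ℤ; +_)
open import Data.Fin using (Fin; toℕ)
open import Data.List using (List; length)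
open import Data.List.Membership.Propositional using (_∈_)
open import Data.List.Relation.Unary.Unique.Propositional using (Unique)
open import Data.Product using (Σ; _×_; ∃; ∃-syntax)
open import Function.Bundles using (_⇔_)
open import Relation.Binary.PropositionalEquality using (_≡_; _≢_)

Σ< : (n : ℕ) → (Fin n → ℕ) → ℕ
Σ< zero    f = 0
Σ< (suc n) f = f Data.Fin.zero + Σ< n (λ i → f (Data.Fin.suc i))

HasSize : {X : Set} → (X → Set) → ℕ → Set
HasSize {X} P k = Σ (List X) λ L → Unique L × (∀ x → (x ∈ L) ⇔ P x) × length L ≡ k

InSet : List ℕ → ℕ → Set
InSet A x = x ∈ A

BSet : List ℕ → ℕ → ℕ → ℕ → Set
BSet A m n x = Σ (Fin n → ℕ) λ a → ((∀ (i : Fin n) → a i ∈ A) × x ≡ Σ< n (λ i → a i * m ^ toℕ i))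

RestrSum : (ℕ → Set) → ℕ → Set
RestrSum S x = ∃[ s ] ∃[ t ] (S s × S t × s ≢ t × x ≡ s + t)

DiffSet : (ℕ → Set) → ℤ → Set
DiffSet S z = ∃[ s ] ∃[ t ] (S s × S t × z ≡ (+ s) ℤ.- (+ t))

-- max(A) for a list of naturals (A nonempty in use, so the seed 0 is harmless)
maxL : List ℕ → ℕ
maxL = Data.List.foldr Data.Nat._⊔_ 0

module Submission where

-- Let M = max A and m > 2M.  Writing numbers in base m, B is the set of
-- n-digit expansions whose digits lie in A.  Every digit set we meet is
-- "small" compared to m:
--   * A and the restricted sumset A ∔ A consist of naturals below m,
--   * A - A consists of integers of absolute value at most M, so two of
--     them differ by less than m.
-- For such digit sets the expansion map (d, e) ↦ d + m·e is injective
-- (uniqueness of base-m digits, proved once over ℤ), so each new digit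
-- multiplies the cardinality by the size of the digit set.  This gives
--   |B| = |A|ⁿ,   |B - B| = |A - A|ⁿ   (since B - B is itself the set of
--   expansions with digits in A - A),
-- and the expansions with digits in A ∔ A form a set of size |A ∔ A|ⁿ
-- inside B ∔ B (the two summands differ in their lowest digit).

open import Defs
open import Data.Nat as ℕ using (ℕ; zero; suc; _+_; _*_; _^_; _≤_; _<_; _>_)
import Data.Nat.Properties as ℕₚ
import Data.Nat.Tactic.RingSolver as ℕ-Solver
open import Data.Integer as ℤ using (ℤ; +_; ∣_∣)
import Data.Integer.Properties as ℤₚ
import Data.Integer.Tactic.RingSolver as ℤ-Solver
open import Data.Fin using (Fin; toℕ) renaming (zero to fzero; suc to fsuc)
open import Data.Vec.Functional using () renaming (_∷_ to _◂_)
open import Data.List using (List; []; _∷_; length; map; filter; _++_; deduplicate; cartesianProduct; cartesianProductWith)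
open import Data.List.Properties using (length-++; length-map)
open import Data.List.Membership.Propositional using (_∈_)
open import Data.List.Membership.Propositional.Properties
  using (∈-map⁺; ∈-map⁻; ∈-++⁺ˡ; ∈-++⁺ʳ; ∈-++⁻; ∈-filter⁺; ∈-filter⁻;
         ∈-cartesianProduct⁺; ∈-cartesianProduct⁻; ∈-cartesianProductWith⁺; ∈-cartesianProductWith⁻;
         ∈-deduplicate⁺; ∈-deduplicate⁻)
import Data.List.Membership.DecPropositional as DecMembership
open import Data.List.Relation.Unary.Any using (here; there)
import Data.List.Relation.Unary.All as All
open import Data.List.Relation.Unary.AllPairs using ([]; _∷_)
open import Data.List.Relation.Unary.Unique.Propositional using (Unique)
import Data.List.Relation.Unary.Unique.Propositional.Properties as Unique
import Data.List.Relation.Unary.Unique.DecPropositional.Properties as DecUnique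
open import Data.Product using (Σ; _×_; _,_; ∃-syntax; proj₁; proj₂; uncurry) renaming (map to map×)
open import Data.Sum using (inj₁; inj₂)
open import Function.Bundles using (_⇔_; mk⇔; Equivalence)
open import Function.Properties.Equivalence using () renaming (refl to ⇔-refl; sym to ⇔-sym; trans to ⇔-trans)
open import Relation.Binary.PropositionalEquality
open import Relation.Binary.Definitions using (DecidableEquality)
open import Relation.Nullary using (¬_; Dec; yes; no; ¬?)

private variable
  X Y Z : Set
  k l m : ℕ

to : {P Q : Set} → P ⇔ Q → P → Q
to = Equivalence.to

from : {P Q : Set} → P ⇔ Q → Q → P
from = Equivalence.from

HasSize-cong : {P Q : X → Set} → (∀ x → P x ⇔ Q x) → HasSize P k → HasSize Q k
HasSize-cong P⇔Q (L , unique , L⇔P , len) =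
  L , unique , (λ x → ⇔-trans (L⇔P x) (P⇔Q x)) , len

singleton-size : (c : X) → HasSize (_≡ c) 1
singleton-size c =
  c ∷ [] , All.[] ∷ [] , (λ x → mk⇔ (λ { (here x≡c) → x≡c ; (there ()) }) here) , refl

Image2 : (X → Y → Z) → (X → Set) → (Y → Set) → Z → Set
Image2 f P Q z = ∃[ x ] ∃[ y ] (P x × Q y × z ≡ f x y)

Image2-cong : {f : X → Y → Z} {P P' : X → Set} {Q Q' : Y → Set} →
              (∀ x → P x ⇔ P' x) → (∀ y → Q y ⇔ Q' y) →
              ∀ z → Image2 f P Q z ⇔ Image2 f P' Q' z
Image2-cong P⇔P' Q⇔Q' z =
  mk⇔ (λ (x , y , px , qy , eq) → x , y , to (P⇔P' x) px , to (Q⇔Q' y) qy , eq)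
      (λ (x , y , px , qy , eq) → x , y , from (P⇔P' x) px , from (Q⇔Q' y) qy , eq)

InjectiveOn : (X → Y → Z) → (X → Set) → (Y → Set) → Set
InjectiveOn f P Q = ∀ {x x' y y'} → P x → P x' → Q y → Q y' →
                    f x y ≡ f x' y' → x ≡ x' × y ≡ y'

map-unique : (g : X → Y) {L : List X} → Unique L →
             (∀ {x x'} → x ∈ L → x' ∈ L → g x ≡ g x' → x ≡ x') → Unique (map g L)
map-unique g []                 inj = []
map-unique g (x∉L ∷ unique) inj =
  All.tabulate (λ z∈ gx≡z → let (x' , x'∈ , z≡gx') = ∈-map⁻ g z∈ in
                 All.lookup x∉L x'∈ (inj (here refl) (there x'∈) (trans gx≡z z≡gx')))
  ∷ map-unique g unique (λ p q → inj (there p) (there q))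

cartesianProductWith-unique : (f : X → Y → Z) {L₁ : List X} {L₂ : List Y} →
  Unique L₁ → Unique L₂ → InjectiveOn f (_∈ L₁) (_∈ L₂) → Unique (cartesianProductWith f L₁ L₂)
cartesianProductWith-unique f {[]}     _               _  inj = []
cartesianProductWith-unique f {x ∷ L₁} {L₂} (x∉L₁ ∷ u₁) u₂ inj =
  Unique.++⁺ (map-unique (f x) u₂ (λ p q eq → proj₂ (inj (here refl) (here refl) p q eq)))
             (cartesianProductWith-unique f u₁ u₂ (λ p q → inj (there p) (there q)))
             disjoint
  where
  disjoint : ∀ {v} → ¬ (v ∈ map (f x) L₂ × v ∈ cartesianProductWith f L₁ L₂)
  disjoint (v∈row , v∈rest) with ∈-map⁻ (f x) v∈row | ∈-cartesianProductWith⁻ f L₁ L₂ v∈rest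
  ... | y , y∈ , v≡fxy | x' , y' , x'∈ , y'∈ , v≡fx'y' =
    All.lookup x∉L₁ x'∈ (proj₁ (inj (here refl) (there x'∈) y∈ y'∈ (trans (sym v≡fxy) v≡fx'y')))

length-cartesianProductWith : (f : X → Y → Z) (L₁ : List X) (L₂ : List Y) →
  length (cartesianProductWith f L₁ L₂) ≡ length L₁ * length L₂
length-cartesianProductWith f []       L₂ = refl
length-cartesianProductWith f (x ∷ L₁) L₂ = begin
  length (map (f x) L₂ ++ cartesianProductWith f L₁ L₂)
    ≡⟨ length-++ (map (f x) L₂) ⟩
  length (map (f x) L₂) + length (cartesianProductWith f L₁ L₂)
    ≡⟨ cong₂ _+_ (length-map (f x) L₂) (length-cartesianProductWith f L₁ L₂) ⟩
  length L₂ + length L₁ * length L₂ ∎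
  where open ≡-Reasoning

Image2-size : {f : X → Y → Z} {P : X → Set} {Q : Y → Set} →
              HasSize P k → HasSize Q l → InjectiveOn f P Q → HasSize (Image2 f P Q) (k * l)
Image2-size {f = f} (L₁ , u₁ , L₁⇔P , refl) (L₂ , u₂ , L₂⇔Q , refl) inj =
  cartesianProductWith f L₁ L₂ ,
  cartesianProductWith-unique f u₁ u₂
    (λ x∈ x'∈ y∈ y'∈ → inj (to (L₁⇔P _) x∈) (to (L₁⇔P _) x'∈) (to (L₂⇔Q _) y∈) (to (L₂⇔Q _) y'∈)) ,
  (λ z → mk⇔ (λ z∈ → let (x , y , x∈ , y∈ , eq) = ∈-cartesianProductWith⁻ f L₁ L₂ z∈ in
                       x , y , to (L₁⇔P x) x∈ , to (L₂⇔Q y) y∈ , eq)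
             (λ { (x , y , px , qy , refl) → ∈-cartesianProductWith⁺ f (from (L₁⇔P x) px) (from (L₂⇔Q y) qy) })) ,
  length-cartesianProductWith f L₁ L₂

Listed : (X → Set) → Set
Listed {X} Q = Σ (List X) λ L → ∀ x → x ∈ L ⇔ Q x

HasSize-listed : {P : X → Set} → HasSize P k → Listed P
HasSize-listed (L , _ , L⇔P , _) = L , L⇔P

-- Over a type with decidable equality, a listed set containing a set of size k is
-- finite of some size ≥ k: enumerate the subset first, then the remaining listed
-- elements without repetition.
listed-superset-size : DecidableEquality X → {P Q : X → Set} → Listed Q → HasSize P k →
                       (∀ {x} → P x → Q x) → Σ ℕ λ l → HasSize Q l × k ≤ l
listed-superset-size {X} _≟_ {Q = Q} (L , L⇔Q) (S , S-unique , S⇔P , refl) P⊆Q =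
  length (S ++ rest) ,
  (S ++ rest , Unique.++⁺ S-unique (Unique.filter⁺ (_∉? S) (deduplicate-! L)) disjoint , members , refl) ,
  ℕₚ.≤-trans (ℕₚ.m≤m+n (length S) (length rest)) (ℕₚ.≤-reflexive (sym (length-++ S)))
  where
  open DecMembership _≟_ using (_∈?_; _∉?_)
  open DecUnique _≟_ using (deduplicate-!)

  rest : List X
  rest = filter (_∉? S) (deduplicate _≟_ L)

  disjoint : ∀ {x} → ¬ (x ∈ S × x ∈ rest)
  disjoint (x∈S , x∈rest) = proj₂ (∈-filter⁻ (_∉? S) {xs = deduplicate _≟_ L} x∈rest) x∈S

  members : ∀ x → x ∈ S ++ rest ⇔ Q x
  members x = mk⇔ into onto
    where
    into : x ∈ S ++ rest → Q x
    into x∈ with ∈-++⁻ S x∈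
    ... | inj₁ x∈S    = P⊆Q (to (S⇔P x) x∈S)
    ... | inj₂ x∈rest = to (L⇔Q x) (∈-deduplicate⁻ _≟_ L (proj₁ (∈-filter⁻ (_∉? S) x∈rest)))

    onto : Q x → x ∈ S ++ rest
    onto qx with x ∈? S
    ... | yes x∈S = ∈-++⁺ˡ x∈S
    ... | no  x∉S = ∈-++⁺ʳ S (∈-filter⁺ (_∉? S) (∈-deduplicate⁺ _≟_ (from (L⇔Q x) qx)) x∉S)

RestrSum-listed : {P : ℕ → Set} → Listed P → Listed (RestrSum P)
RestrSum-listed {P} (L , L⇔P) = sums , members
  where
  Distinct : ℕ × ℕ → Set
  Distinct (s , t) = s ≢ t

  distinct? : (p : ℕ × ℕ) → Dec (Distinct p)
  distinct? (s , t) = ¬? (s ℕ.≟ t)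

  sums : List ℕ
  sums = map (uncurry _+_) (filter distinct? (cartesianProduct L L))

  members : ∀ x → x ∈ sums ⇔ RestrSum P x
  members x = mk⇔ into onto
    where
    into : x ∈ sums → RestrSum P x
    into x∈ with ∈-map⁻ (uncurry _+_) x∈
    ... | (s , t) , p∈ , refl with ∈-filter⁻ distinct? p∈
    ...   | p∈L² , s≢t with ∈-cartesianProduct⁻ L L p∈L²
    ...     | s∈ , t∈ = s , t , to (L⇔P s) s∈ , to (L⇔P t) t∈ , s≢t , refl

    onto : RestrSum P x → x ∈ sums
    onto (s , t , ps , pt , s≢t , refl) =
      ∈-map⁺ (uncurry _+_) (∈-filter⁺ distinct? (∈-cartesianProduct⁺ (from (L⇔P s) ps) (from (L⇔P t) pt)) s≢t)

digit : ℕ → ℕ → ℕ → ℕ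
digit m a y = a + m * y

digitℤ : ℕ → ℤ → ℤ → ℤ
digitℤ m d e = d ℤ.+ + m ℤ.* e

digit-cast : ∀ m a y → + digit m a y ≡ digitℤ m (+ a) (+ y)
digit-cast m a y = trans (ℤₚ.pos-+ a (m * y)) (cong (ℤ._+_ (+ a)) (ℤₚ.pos-* m y))

-- Uniqueness of base-m digits: if two lowest digits differ by less than m, then
-- d + m·e determines both d and e.  Digits may be negative, as in B - B.
digitℤ-injective : ∀ {d d' e e'} → ∣ d ℤ.- d' ∣ < m →
                   digitℤ m d e ≡ digitℤ m d' e' → d ≡ d' × e ≡ e'
digitℤ-injective {m} {d} {d'} {e} {e'} close eq = d≡d' , sym e'≡e
  where
  open ≡-Reasoning

  regroup : ∀ d d' e e' k → d ℤ.- d' ≡ ((d ℤ.+ k ℤ.* e) ℤ.- (d' ℤ.+ k ℤ.* e')) ℤ.+ k ℤ.* (e' ℤ.- e)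
  regroup = ℤ-Solver.solve-∀

  d-d'≡m[e'-e] : d ℤ.- d' ≡ + m ℤ.* (e' ℤ.- e)
  d-d'≡m[e'-e] = begin
    d ℤ.- d'                                                     ≡⟨ regroup d d' e e' (+ m) ⟩
    (digitℤ m d e ℤ.- digitℤ m d' e') ℤ.+ + m ℤ.* (e' ℤ.- e)    ≡⟨ cong (λ t → (t ℤ.- digitℤ m d' e') ℤ.+ + m ℤ.* (e' ℤ.- e)) eq ⟩
    (digitℤ m d' e' ℤ.- digitℤ m d' e') ℤ.+ + m ℤ.* (e' ℤ.- e)  ≡⟨ cong (ℤ._+ + m ℤ.* (e' ℤ.- e)) (ℤₚ.+-inverseʳ (digitℤ m d' e')) ⟩
    + 0 ℤ.+ + m ℤ.* (e' ℤ.- e)                                   ≡⟨ ℤₚ.+-identityˡ _ ⟩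
    + m ℤ.* (e' ℤ.- e)                                           ∎

  -- a multiple of m smaller than m in absolute value is zero
  m∣e'-e∣<m*1 : m * ∣ e' ℤ.- e ∣ < m * 1
  m∣e'-e∣<m*1 = subst₂ _<_ (trans (cong ∣_∣ d-d'≡m[e'-e]) (ℤₚ.abs-* (+ m) (e' ℤ.- e)))
                           (sym (ℕₚ.*-identityʳ m)) close

  e'-e≡0 : e' ℤ.- e ≡ + 0
  e'-e≡0 = ℤₚ.∣i∣≡0⇒i≡0 (ℕₚ.n<1⇒n≡0 (ℕₚ.*-cancelˡ-< m _ 1 m∣e'-e∣<m*1))

  e'≡e : e' ≡ e
  e'≡e = ℤₚ.i-j≡0⇒i≡j e' e e'-e≡0

  d≡d' : d ≡ d'
  d≡d' = ℤₚ.i-j≡0⇒i≡j d d' (trans d-d'≡m[e'-e] (trans (cong (+ m ℤ.*_) e'-e≡0) (ℤₚ.*-zeroʳ (+ m))))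

digit-injective : ∀ {a a' y y'} → a < m → a' < m → digit m a y ≡ digit m a' y' → a ≡ a' × y ≡ y'
digit-injective {m} {a} {a'} {y} {y'} a<m a'<m eq =
  map× ℤₚ.+-injective ℤₚ.+-injective
       (digitℤ-injective close (trans (sym (digit-cast m a y)) (trans (cong +_ eq) (digit-cast m a' y'))))
  where
  close : ∣ + a ℤ.- + a' ∣ < m
  close = subst (_< m) (sym (cong ∣_∣ (ℤₚ.[+m]-[+n]≡m⊖n a a')))
                (ℕₚ.≤-<-trans (ℤₚ.∣m⊝n∣≤m⊔n a a') (ℕₚ.⊔-lub a<m a'<m))

Expansions : ℕ → (ℕ → Set) → ℕ → ℕ → Set
Expansions m D zero    = _≡ 0
Expansions m D (suc n) = Image2 (digit m) D (Expansions m D n)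

Expansions-size : {D : ℕ → Set} → (∀ {a} → D a → a < m) → HasSize D k →
                  ∀ n → HasSize (Expansions m D n) (k ^ n)
Expansions-size small hD zero    = singleton-size 0
Expansions-size small hD (suc n) =
  Image2-size hD (Expansions-size small hD n) (λ da da' _ _ → digit-injective (small da) (small da'))

Σ<-factor : ∀ n k (a g : Fin n → ℕ) → Σ< n (λ i → a i * (k * g i)) ≡ k * Σ< n (λ i → a i * g i)
Σ<-factor zero    k a g = sym (ℕₚ.*-zeroʳ k)
Σ<-factor (suc n) k a g = begin
  a fzero * (k * g fzero) + Σ< n (λ i → a (fsuc i) * (k * g (fsuc i)))
    ≡⟨ cong₂ _+_ (swap (a fzero) k (g fzero)) (Σ<-factor n k (λ i → a (fsuc i)) (λ i → g (fsuc i))) ⟩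
  k * (a fzero * g fzero) + k * Σ< n (λ i → a (fsuc i) * g (fsuc i))
    ≡⟨ sym (ℕₚ.*-distribˡ-+ k (a fzero * g fzero) _) ⟩
  k * (a fzero * g fzero + Σ< n (λ i → a (fsuc i) * g (fsuc i))) ∎
  where
  open ≡-Reasoning
  swap : ∀ x k y → x * (k * y) ≡ k * (x * y)
  swap = ℕ-Solver.solve-∀

horner : ∀ n m (a : Fin (suc n) → ℕ) →
         Σ< (suc n) (λ i → a i * m ^ toℕ i) ≡ digit m (a fzero) (Σ< n (λ i → a (fsuc i) * m ^ toℕ i))
horner n m a = cong₂ _+_ (ℕₚ.*-identityʳ (a fzero)) (Σ<-factor n m (λ i → a (fsuc i)) (λ i → m ^ toℕ i))

BSet-step : ∀ A m n x → BSet A m (suc n) x ⇔ Image2 (digit m) (InSet A) (BSet A m n) x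
BSet-step A m n x = mk⇔ split join
  where
  split : BSet A m (suc n) x → Image2 (digit m) (InSet A) (BSet A m n) x
  split (a , a∈A , x≡) =
    a fzero , _ , a∈A fzero , ((λ i → a (fsuc i)) , (λ i → a∈A (fsuc i)) , refl) , trans x≡ (horner n m a)

  join : Image2 (digit m) (InSet A) (BSet A m n) x → BSet A m (suc n) x
  join (a₀ , _ , a₀∈A , (a , a∈A , refl) , x≡) =
    a₀ ◂ a , (λ { fzero → a₀∈A ; (fsuc i) → a∈A i }) , trans x≡ (sym (horner n m (a₀ ◂ a)))

BSet⇔Expansions : ∀ A m n x → BSet A m n x ⇔ Expansions m (InSet A) n x
BSet⇔Expansions A m zero    x = mk⇔ (λ (_ , _ , x≡0) → x≡0) (λ x≡0 → (λ ()) , (λ ()) , x≡0)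
BSet⇔Expansions A m (suc n) x =
  ⇔-trans (BSet-step A m n x) (Image2-cong (λ _ → ⇔-refl) (BSet⇔Expansions A m n) x)

DiffSet-cong : {P Q : ℕ → Set} → (∀ x → P x ⇔ Q x) → ∀ z → DiffSet P z ⇔ DiffSet Q z
DiffSet-cong P⇔Q = Image2-cong P⇔Q P⇔Q

-- Differences of expansions are expansions of differences:
-- (a + m·y) - (a' + m·y') = (a - a') + m·(y - y').
DiffSet-digits : {P Q : ℕ → Set} →
                 ∀ z → DiffSet (Image2 (digit m) P Q) z ⇔ Image2 (digitℤ m) (DiffSet P) (DiffSet Q) z
DiffSet-digits {m} z = mk⇔ split join
  where
  regroup : ∀ a a' y y' k → (a ℤ.+ k ℤ.* y) ℤ.- (a' ℤ.+ k ℤ.* y') ≡ (a ℤ.- a') ℤ.+ k ℤ.* (y ℤ.- y')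
  regroup = ℤ-Solver.solve-∀

  digitwise : ∀ a a' y y' → + digit m a y ℤ.- + digit m a' y' ≡ digitℤ m (+ a ℤ.- + a') (+ y ℤ.- + y')
  digitwise a a' y y' =
    trans (cong₂ ℤ._-_ (digit-cast m a y) (digit-cast m a' y')) (regroup (+ a) (+ a') (+ y) (+ y') (+ m))

  split : DiffSet (Image2 (digit m) _ _) z → Image2 (digitℤ m) (DiffSet _) (DiffSet _) z
  split (_ , _ , (a , y , pa , qy , refl) , (a' , y' , pa' , qy' , refl) , z≡) =
    _ , _ , (a , a' , pa , pa' , refl) , (y , y' , qy , qy' , refl) , trans z≡ (digitwise a a' y y')

  join : Image2 (digitℤ m) (DiffSet _) (DiffSet _) z → DiffSet (Image2 (digit m) _ _) z
  join (_ , _ , (a , a' , pa , pa' , refl) , (y , y' , qy , qy' , refl) , z≡) =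
    _ , _ , (a , y , pa , qy , refl) , (a' , y' , pa' , qy' , refl) , trans z≡ (sym (digitwise a a' y y'))

DiffSet-bounded : ∀ {M} {D : ℕ → Set} → (∀ {a} → D a → a ≤ M) → ∀ {d} → DiffSet D d → ∣ d ∣ ≤ M
DiffSet-bounded small (a , a' , da , da' , refl) =
  subst (_≤ _) (sym (cong ∣_∣ (ℤₚ.[+m]-[+n]≡m⊖n a a')))
        (ℕₚ.≤-trans (ℤₚ.∣m⊝n∣≤m⊔n a a') (ℕₚ.⊔-lub (small da) (small da')))

-- If D ⊆ [0, M] and 2M < m, the difference set of the n-digit expansions over D has
-- |D - D|ⁿ elements: it consists of the expansions with digits in D - D, and two such
-- digits differ by at most 2M < m, so the digits are unique.
DiffSet-Expansions-size : ∀ {M} {D : ℕ → Set} → (∀ {a} → D a → a ≤ M) → M + M < m →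
                          HasSize (DiffSet D) k → ∀ n → HasSize (DiffSet (Expansions m D n)) (k ^ n)
DiffSet-Expansions-size small 2M<m hD zero =
  HasSize-cong (λ z → mk⇔ (λ { refl → 0 , 0 , refl , refl , refl }) (λ { (_ , _ , refl , refl , z≡) → z≡ }))
               (singleton-size (+ 0))
DiffSet-Expansions-size {m} small 2M<m hD (suc n) =
  HasSize-cong (λ z → ⇔-sym (DiffSet-digits {m} z))
               (Image2-size hD (DiffSet-Expansions-size small 2M<m hD n)
                            (λ dd dd' _ _ → digitℤ-injective {m} (close dd dd')))
  where
  close : ∀ {d d'} → DiffSet _ d → DiffSet _ d' → ∣ d ℤ.- d' ∣ < m
  close {d} {d'} dd dd' =
    ℕₚ.≤-<-trans (ℕₚ.≤-trans (ℤₚ.∣i-j∣≤∣i∣+∣j∣ d d')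
                             (ℕₚ.+-mono-≤ (DiffSet-bounded small dd) (DiffSet-bounded small dd')))
                 2M<m

RestrSum-cong : {P Q : ℕ → Set} → (∀ x → P x ⇔ Q x) → ∀ x → RestrSum P x ⇔ RestrSum Q x
RestrSum-cong P⇔Q x =
  mk⇔ (λ (s , t , ps , pt , s≢t , x≡) → s , t , to (P⇔Q s) ps , to (P⇔Q t) pt , s≢t , x≡)
      (λ (s , t , qs , qt , s≢t , x≡) → s , t , from (P⇔Q s) qs , from (P⇔Q t) qt , s≢t , x≡)

digit-+ : ∀ m a a' s t → (a + a') + m * (s + t) ≡ (a + m * s) + (a' + m * t)
digit-+ = ℕ-Solver.solve-∀

Expansions-of-sums : {D : ℕ → Set} → ∀ n {x} →
  Expansions m (RestrSum D) n x → Image2 _+_ (Expansions m D n) (Expansions m D n) x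
Expansions-of-sums zero    refl = 0 , 0 , refl , refl , refl
Expansions-of-sums {m} (suc n) (_ , _ , (a , a' , da , da' , _ , refl) , ey , refl)
  with Expansions-of-sums n ey
... | s , t , es , et , refl =
  digit m a s , digit m a' t , (a , s , da , es , refl) , (a' , t , da' , et , refl) , digit-+ m a a' s t

-- If moreover the digits of D are below m, the two summands differ in their lowest
-- digit, hence are distinct: expansions over D ∔ D lie in the restricted sumset.
Expansions-of-restrSums : {D : ℕ → Set} → (∀ {a} → D a → a < m) → ∀ n {x} →
  Expansions m (RestrSum D) (suc n) x → RestrSum (Expansions m D (suc n)) x
Expansions-of-restrSums {m} small n (_ , _ , (a , a' , da , da' , a≢a' , refl) , ey , refl)
  with Expansions-of-sums n ey
... | s , t , es , et , refl =
  digit m a s , digit m a' t , (a , s , da , es , refl) , (a' , t , da' , et , refl) ,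
  (λ eq → a≢a' (proj₁ (digit-injective (small da) (small da') eq))) , digit-+ m a a' s t

maxL-upper : ∀ A {a} → a ∈ A → a ≤ maxL A
maxL-upper (x ∷ A) (here refl) = ℕₚ.m≤m⊔n x (maxL A)
maxL-upper (x ∷ A) (there a∈A) = ℕₚ.≤-trans (maxL-upper A a∈A) (ℕₚ.m≤n⊔m x (maxL A))

lemma3 : (A : List ℕ) → Unique A → 1 ≤ length A →
         (m n : ℕ) → 1 ≤ m → m > 2 * maxL A → 1 ≤ n →
         HasSize (BSet A m n) (length A ^ n)
         × (∀ j → HasSize (RestrSum (InSet A)) j →
              Σ ℕ λ k → HasSize (RestrSum (BSet A m n)) k × j ^ n ≤ k)
         × (∀ d → HasSize (DiffSet (InSet A)) d →
              HasSize (DiffSet (BSet A m n)) (d ^ n))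
lemma3 A A-unique _ m (suc n) _ 2M<m _ = B-size , restricted , differences
  where
  M = maxL A

  M+M<m : M + M < m
  M+M<m = subst (λ t → M + t < m) (ℕₚ.+-identityʳ M) 2M<m

  A-digit : ∀ {a} → InSet A a → a < m
  A-digit a∈A = ℕₚ.≤-<-trans (maxL-upper A a∈A) (ℕₚ.≤-<-trans (ℕₚ.m≤m+n M M) M+M<m)

  A∔A-digit : ∀ {c} → RestrSum (InSet A) c → c < m
  A∔A-digit (_ , _ , a∈A , a'∈A , _ , refl) =
    ℕₚ.≤-<-trans (ℕₚ.+-mono-≤ (maxL-upper A a∈A) (maxL-upper A a'∈A)) M+M<m

  B⇔ : ∀ x → Expansions m (InSet A) (suc n) x ⇔ BSet A m (suc n) x
  B⇔ x = ⇔-sym (BSet⇔Expansions A m (suc n) x)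

  B-size : HasSize (BSet A m (suc n)) (length A ^ suc n)
  B-size = HasSize-cong B⇔ (Expansions-size A-digit (A , A-unique , (λ _ → ⇔-refl) , refl) (suc n))

  -- the expansions with digits in A ∔ A are |A ∔ A|ⁿ elements of B ∔ B
  restricted : ∀ j → HasSize (RestrSum (InSet A)) j →
               Σ ℕ λ k → HasSize (RestrSum (BSet A m (suc n))) k × j ^ suc n ≤ k
  restricted j A∔A-size =
    listed-superset-size ℕ._≟_ (RestrSum-listed (HasSize-listed B-size))
                         (Expansions-size A∔A-digit A∔A-size (suc n))
                         (λ e → to (RestrSum-cong B⇔ _) (Expansions-of-restrSums A-digit n e))

  differences : ∀ d → HasSize (DiffSet (InSet A)) d → HasSize (DiffSet (BSet A m (suc n))) (d ^ suc n)
  differences d A-A-size =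
    HasSize-cong (DiffSet-cong B⇔) (DiffSet-Expansions-size (maxL-upper A) M+M<m A-A-size (suc n))
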